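{- For every positive integer $m$ and complex $q$ with $|q|<1$, $$\sum_{n\geq1} \frac{q^{2mn}}{1-q^n}=\sum_{n\geq1} \frac{(-1)^{n-1}q^{(2m-1)n}q^{\binom{n+1}2}}{(1-q^n)(q^{2m};q)_n}.$$
   Context: $(a;q)_n=\prod_{j=0}^{n-1}(1-aq^j)$. -}

module Defs where

open import Data.Nat as ℕ using (ℕ; zero; suc; _≡ᵇ_)
open import Data.Integer as ℤ using (ℤ; +_; -_)
open import Data.List using (List; []; _∷_; map; upTo; zipWith; foldr)
open import Data.Bool using (if_then_else_)
open import Relation.Binary.PropositionalEquality using (_≡_)

sum : List ℤ → ℤ
sum = foldr ℤ._+_ (+ 0)

-- A formal power series: k ↦ coefficient of q^k.
Series : Set
Series = ℕ → ℤ

qpow : ℕ → Series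
qpow e k = if k ≡ᵇ e then + 1 else + 0

𝟙 : Series
𝟙 = qpow 0

_⊕_ : Series → Series → Series
(f ⊕ g) k = f k ℤ.+ g k

_⊖_ : Series → Series → Series
(f ⊖ g) k = f k ℤ.- g k

_·_ : ℤ → Series → Series
(c · f) k = c ℤ.* f k

_⊛_ : Series → Series → Series
(f ⊛ g) k = sum (map (λ i → f i ℤ.* g (k ℕ.∸ i)) (upTo (suc k)))

infixl 7 _⊛_ _·_
infixl 6 _⊕_ _⊖_

-- Multiplicative inverse of a series with constant term 1.
-- invRev f k = [b_k, b_{k-1}, …, b_0] where b = 1/f, computed by
-- b_0 = 1, b_{k+1} = - Σ_{i=1}^{k+1} f_i b_{k+1-i}.
invRev : Series → ℕ → List ℤ
invRev f zero = + 1 ∷ []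
invRev f (suc k) =
  (- sum (zipWith ℤ._*_ (map (λ j → f (suc j)) (upTo (suc k))) (invRev f k)))
  ∷ invRev f k

inv : Series → Series
inv f k with invRev f k
... | [] = + 0
... | b ∷ _ = b

qPoch : Series → ℕ → Series
qPoch a zero = 𝟙
qPoch a (suc n) = qPoch a n ⊛ (𝟙 ⊖ a ⊛ qpow n)

-- Σ_{n ≥ 1} T n, for a family with T n ∈ q^n ℤ[[q]] (valuation ≥ n),
-- so the coefficient of q^k only receives contributions from 1 ≤ n ≤ k.
Σ≥1 : (ℕ → Series) → Series
Σ≥1 T k = sum (map (λ i → T (suc i) k) (upTo k))

_≈_ : Series → Series → Set
f ≈ g = ∀ k → f k ≡ g k
infix 4 _≈_

{-# OPTIONS --safe #-}
module Submission where

-- The identity holds with 2m replaced by any s ≥ 1; let d_s(n) be the difference of the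
-- n-th terms of its two sides.  Passing from s to s + 1 changes the n-th left term by
-- q^{sn} and the n-th right term by t_s(n) = (-1)^{n-1} q^{sn+C(n,2)} / (q^s;q)_{n+1}.
-- Both changes telescope: Σ_{n≤N} q^{sn} = W_0 - W_N and Σ_{n≤N} t_s(n) = V_0 - V_N for the
-- tails W_N = q^{s(N+1)} / (1-q^s) and V_N = (-1)^N q^{s(N+1)+C(N+1,2)} / (q^s;q)_{N+1},
-- with W_0 = V_0.  Since q^{N+1} divides W_N and V_N, the N-th partial sums of d_s and
-- d_{s+1} agree modulo q^{N+1}.  Every d_{s'}(n) is divisible by q^{s'}, so comparing with
-- s' = s + N shows that the N-th partial sum of d_s vanishes modulo q^{N+1}: its
-- coefficient of q^N, which is the N-th coefficient of the difference of the two sides,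
-- is zero.

open import Defs
open import Data.Nat using (ℕ; suc; _*_; _∸_; _≤_)
open import Data.Nat.Combinatorics using (_C_)
open import Data.Integer using (-_; +_) renaming (_^_ to _^ℤ_)

open import Algebra.Bundles using (CommutativeRing)
import Algebra.Consequences.Setoid as Consequences
import Algebra.Construct.Pointwise ℕ as Pointwise
import Algebra.Solver.Ring as RingSolver
open import Algebra.Solver.Ring.AlmostCommutativeRing
  using (fromCommutativeRing; _-Raw-AlmostCommutative⟶_)
open import Algebra.Structures using (IsAbelianGroup)
open import Data.Integer as ℤ using (ℤ)
import Data.Integer.Properties as ℤP
import Data.Integer.Tactic.RingSolver as ℤSolver
open import Data.List using ([]; _∷_; map; upTo; zipWith)
open import Data.List.Properties using (map-applyUpTo; map-upTo; map-cong)
open import Data.Maybe using (Maybe; just; nothing)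
open import Data.Nat using (zero; _+_; _<_; z≤n; s≤s)
open import Data.Nat.Combinatorics using (nC1≡n; nCk+nC[k+1]≡[n+1]C[k+1])
import Data.Nat.Properties as ℕP
open import Algebra.Properties.CommutativeSemigroup ℕP.+-commutativeSemigroup
  using () renaming (x∙yz≈y∙xz to +-x∙yz≈y∙xz)
open import Function using (_∘_)
open import Relation.Binary.PropositionalEquality
  using (_≡_; refl; sym; trans; cong; cong₂; module ≡-Reasoning)
open import Relation.Nullary using (yes; no)

sum-map-upTo-suc : ∀ (F : ℕ → ℤ) n →
  sum (map F (upTo (suc n))) ≡ F 0 ℤ.+ sum (map (F ∘ suc) (upTo n))
sum-map-upTo-suc F n = cong (λ xs → F 0 ℤ.+ sum xs)
  (trans (map-applyUpTo suc F n) (sym (map-upTo (F ∘ suc) n)))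

sum-map-upTo-snoc : ∀ (F : ℕ → ℤ) n →
  sum (map F (upTo (suc n))) ≡ sum (map F (upTo n)) ℤ.+ F n
sum-map-upTo-snoc F zero    = ℤP.+-comm (F 0) (+ 0)
sum-map-upTo-snoc F (suc n) = begin
  sum (map F (upTo (suc (suc n))))
    ≡⟨ sum-map-upTo-suc F (suc n) ⟩
  F 0 ℤ.+ sum (map (F ∘ suc) (upTo (suc n)))
    ≡⟨ cong (ℤ._+_ (F 0)) (sum-map-upTo-snoc (F ∘ suc) n) ⟩
  F 0 ℤ.+ (sum (map (F ∘ suc) (upTo n)) ℤ.+ F (suc n))
    ≡⟨ ℤP.+-assoc (F 0) _ (F (suc n)) ⟨
  F 0 ℤ.+ sum (map (F ∘ suc) (upTo n)) ℤ.+ F (suc n)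
    ≡⟨ cong (ℤ._+ F (suc n)) (sum-map-upTo-suc F n) ⟨
  sum (map F (upTo (suc n))) ℤ.+ F (suc n)
    ∎
  where open ≡-Reasoning

zipWith-*-map : ∀ (g h : ℕ → ℤ) xs →
  zipWith ℤ._*_ (map g xs) (map h xs) ≡ map (λ i → g i ℤ.* h i) xs
zipWith-*-map g h []       = refl
zipWith-*-map g h (x ∷ xs) = cong (g x ℤ.* h x ∷_) (zipWith-*-map g h xs)

shift : Series → Series
shift f k = f (suc k)

⊛-coeff-zero : ∀ f g → (f ⊛ g) 0 ≡ f 0 ℤ.* g 0
⊛-coeff-zero f g = ℤP.+-identityʳ (f 0 ℤ.* g 0)

⊛-coeff-suc : ∀ f g k → (f ⊛ g) (suc k) ≡ f 0 ℤ.* g (suc k) ℤ.+ (shift f ⊛ g) k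
⊛-coeff-suc f g k = sum-map-upTo-suc (λ i → f i ℤ.* g (suc k ∸ i)) (suc k)

⊛-coeff-sucʳ : ∀ f g k → (f ⊛ g) (suc k) ≡ (f ⊛ shift g) k ℤ.+ f (suc k) ℤ.* g 0
⊛-coeff-sucʳ f g zero    = trans (⊛-coeff-suc f g 0)
  (cong₂ ℤ._+_ (sym (⊛-coeff-zero f (shift g))) (⊛-coeff-zero (shift f) g))
⊛-coeff-sucʳ f g (suc k) = begin
  (f ⊛ g) (suc (suc k))                              ≡⟨ ⊛-coeff-suc f g (suc k) ⟩
  first ℤ.+ (shift f ⊛ g) (suc k)                    ≡⟨ cong (ℤ._+_ first) (⊛-coeff-sucʳ (shift f) g k) ⟩
  first ℤ.+ ((shift f ⊛ shift g) k ℤ.+ last)         ≡⟨ ℤP.+-assoc first _ last ⟨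
  first ℤ.+ (shift f ⊛ shift g) k ℤ.+ last           ≡⟨ cong (ℤ._+ last) (⊛-coeff-suc f (shift g) k) ⟨
  (f ⊛ shift g) (suc k) ℤ.+ last                     ∎
  where
  first = f 0 ℤ.* g (suc (suc k))
  last  = f (suc (suc k)) ℤ.* g 0
  open ≡-Reasoning

infix 4 q^_∣_
q^_∣_ : ℕ → Series → Set
q^ e ∣ f = ∀ k → k < e → f k ≡ + 0

q^∣-⊛ʳ : ∀ {e f} g → q^ e ∣ f → q^ e ∣ f ⊛ g
q^∣-⊛ʳ {f = f} g f≡0 zero 0<e = trans (⊛-coeff-zero f g) (cong (ℤ._* g 0) (f≡0 0 0<e))
q^∣-⊛ʳ {suc e} {f} g f≡0 (suc k) (s≤s k<e) = trans (⊛-coeff-suc f g k)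
  (cong₂ ℤ._+_ (cong (ℤ._* g (suc k)) (f≡0 0 (s≤s z≤n)))
               (q^∣-⊛ʳ g (λ i i<e → f≡0 (suc i) (s≤s i<e)) k k<e))

⊛-cong : ∀ {f f′ g g′} → f ≈ f′ → g ≈ g′ → f ⊛ g ≈ f′ ⊛ g′
⊛-cong f≈f′ g≈g′ k =
  cong sum (map-cong (λ i → cong₂ ℤ._*_ (f≈f′ i) (g≈g′ (k ∸ i))) (upTo (suc k)))

⊛-identityˡ : ∀ f → 𝟙 ⊛ f ≈ f
⊛-identityˡ f zero    = trans (⊛-coeff-zero 𝟙 f) (ℤP.*-identityˡ (f 0))
⊛-identityˡ f (suc k) = trans (⊛-coeff-suc 𝟙 f k)
  (trans (cong₂ ℤ._+_ (ℤP.*-identityˡ (f (suc k)))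
                      (q^∣-⊛ʳ {f = shift 𝟙} f (λ _ _ → refl) k (ℕP.n<1+n k)))
         (ℤP.+-identityʳ (f (suc k))))

⊛-comm : ∀ f g → f ⊛ g ≈ g ⊛ f
⊛-comm f g zero    =
  trans (⊛-coeff-zero f g) (trans (ℤP.*-comm (f 0) (g 0)) (sym (⊛-coeff-zero g f)))
⊛-comm f g (suc k) = begin
  (f ⊛ g) (suc k)
    ≡⟨ ⊛-coeff-suc f g k ⟩
  f 0 ℤ.* g (suc k) ℤ.+ (shift f ⊛ g) k
    ≡⟨ cong₂ ℤ._+_ (ℤP.*-comm (f 0) (g (suc k))) (⊛-comm (shift f) g k) ⟩
  g (suc k) ℤ.* f 0 ℤ.+ (g ⊛ shift f) k
    ≡⟨ ℤP.+-comm (g (suc k) ℤ.* f 0) _ ⟩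
  (g ⊛ shift f) k ℤ.+ g (suc k) ℤ.* f 0
    ≡⟨ ⊛-coeff-sucʳ g f k ⟨
  (g ⊛ f) (suc k)
    ∎
  where open ≡-Reasoning

⊛-distribʳ : ∀ h f g → (f ⊕ g) ⊛ h ≈ f ⊛ h ⊕ g ⊛ h
⊛-distribʳ h f g zero    = begin
  ((f ⊕ g) ⊛ h) 0              ≡⟨ ⊛-coeff-zero (f ⊕ g) h ⟩
  (f 0 ℤ.+ g 0) ℤ.* h 0        ≡⟨ ℤP.*-distribʳ-+ (h 0) (f 0) (g 0) ⟩
  f 0 ℤ.* h 0 ℤ.+ g 0 ℤ.* h 0  ≡⟨ cong₂ ℤ._+_ (⊛-coeff-zero f h) (⊛-coeff-zero g h) ⟨
  (f ⊛ h) 0 ℤ.+ (g ⊛ h) 0      ∎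
  where open ≡-Reasoning
⊛-distribʳ h f g (suc k) = begin
  ((f ⊕ g) ⊛ h) (suc k)
    ≡⟨ ⊛-coeff-suc (f ⊕ g) h k ⟩
  (f 0 ℤ.+ g 0) ℤ.* h (suc k) ℤ.+ ((shift f ⊕ shift g) ⊛ h) k
    ≡⟨ cong (ℤ._+_ ((f 0 ℤ.+ g 0) ℤ.* h (suc k))) (⊛-distribʳ h (shift f) (shift g) k) ⟩
  (f 0 ℤ.+ g 0) ℤ.* h (suc k) ℤ.+ ((shift f ⊛ h) k ℤ.+ (shift g ⊛ h) k)
    ≡⟨ regroup (f 0) (g 0) (h (suc k)) _ _ ⟩
  (f 0 ℤ.* h (suc k) ℤ.+ (shift f ⊛ h) k) ℤ.+ (g 0 ℤ.* h (suc k) ℤ.+ (shift g ⊛ h) k)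
    ≡⟨ cong₂ ℤ._+_ (⊛-coeff-suc f h k) (⊛-coeff-suc g h k) ⟨
  (f ⊛ h) (suc k) ℤ.+ (g ⊛ h) (suc k)
    ∎
  where
  open ≡-Reasoning
  regroup : ∀ a b c x y →
    (a ℤ.+ b) ℤ.* c ℤ.+ (x ℤ.+ y) ≡ (a ℤ.* c ℤ.+ x) ℤ.+ (b ℤ.* c ℤ.+ y)
  regroup = ℤSolver.solve-∀

⊛-·ˡ : ∀ c f g → (c · f) ⊛ g ≈ c · (f ⊛ g)
⊛-·ˡ c f g zero    = begin
  ((c · f) ⊛ g) 0      ≡⟨ ⊛-coeff-zero (c · f) g ⟩
  c ℤ.* f 0 ℤ.* g 0    ≡⟨ ℤP.*-assoc c (f 0) (g 0) ⟩
  c ℤ.* (f 0 ℤ.* g 0)  ≡⟨ cong (c ℤ.*_) (⊛-coeff-zero f g) ⟨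
  c ℤ.* (f ⊛ g) 0      ∎
  where open ≡-Reasoning
⊛-·ˡ c f g (suc k) = begin
  ((c · f) ⊛ g) (suc k)
    ≡⟨ ⊛-coeff-suc (c · f) g k ⟩
  c ℤ.* f 0 ℤ.* g (suc k) ℤ.+ ((c · shift f) ⊛ g) k
    ≡⟨ cong (ℤ._+_ (c ℤ.* f 0 ℤ.* g (suc k))) (⊛-·ˡ c (shift f) g k) ⟩
  c ℤ.* f 0 ℤ.* g (suc k) ℤ.+ c ℤ.* (shift f ⊛ g) k
    ≡⟨ factor c (f 0) (g (suc k)) _ ⟩
  c ℤ.* (f 0 ℤ.* g (suc k) ℤ.+ (shift f ⊛ g) k)
    ≡⟨ cong (c ℤ.*_) (⊛-coeff-suc f g k) ⟨
  c ℤ.* (f ⊛ g) (suc k)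
    ∎
  where
  open ≡-Reasoning
  factor : ∀ a b c d → a ℤ.* b ℤ.* c ℤ.+ a ℤ.* d ≡ a ℤ.* (b ℤ.* c ℤ.+ d)
  factor = ℤSolver.solve-∀

⊛-assoc : ∀ f g h → (f ⊛ g) ⊛ h ≈ f ⊛ (g ⊛ h)
⊛-assoc f g h zero    = begin
  ((f ⊛ g) ⊛ h) 0        ≡⟨ ⊛-coeff-zero (f ⊛ g) h ⟩
  (f ⊛ g) 0 ℤ.* h 0      ≡⟨ cong (ℤ._* h 0) (⊛-coeff-zero f g) ⟩
  f 0 ℤ.* g 0 ℤ.* h 0    ≡⟨ ℤP.*-assoc (f 0) (g 0) (h 0) ⟩
  f 0 ℤ.* (g 0 ℤ.* h 0)  ≡⟨ cong (f 0 ℤ.*_) (⊛-coeff-zero g h) ⟨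
  f 0 ℤ.* (g ⊛ h) 0      ≡⟨ ⊛-coeff-zero f (g ⊛ h) ⟨
  (f ⊛ (g ⊛ h)) 0        ∎
  where open ≡-Reasoning
⊛-assoc f g h (suc k) = begin
  ((f ⊛ g) ⊛ h) (suc k)
    ≡⟨ ⊛-coeff-suc (f ⊛ g) h k ⟩
  (f ⊛ g) 0 ℤ.* h (suc k) ℤ.+ (shift (f ⊛ g) ⊛ h) k
    ≡⟨ cong₂ ℤ._+_ (cong (ℤ._* h (suc k)) (⊛-coeff-zero f g)) shifted ⟩
  f 0 ℤ.* g 0 ℤ.* h (suc k) ℤ.+ (f 0 ℤ.* (shift g ⊛ h) k ℤ.+ (shift f ⊛ (g ⊛ h)) k)
    ≡⟨ regroup (f 0) (g 0) (h (suc k)) _ _ ⟩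
  f 0 ℤ.* (g 0 ℤ.* h (suc k) ℤ.+ (shift g ⊛ h) k) ℤ.+ (shift f ⊛ (g ⊛ h)) k
    ≡⟨ cong (λ x → f 0 ℤ.* x ℤ.+ (shift f ⊛ (g ⊛ h)) k) (⊛-coeff-suc g h k) ⟨
  f 0 ℤ.* (g ⊛ h) (suc k) ℤ.+ (shift f ⊛ (g ⊛ h)) k
    ≡⟨ ⊛-coeff-suc f (g ⊛ h) k ⟨
  (f ⊛ (g ⊛ h)) (suc k)
    ∎
  where
  open ≡-Reasoning
  shifted : (shift (f ⊛ g) ⊛ h) k ≡ f 0 ℤ.* (shift g ⊛ h) k ℤ.+ (shift f ⊛ (g ⊛ h)) k
  shifted = begin
    (shift (f ⊛ g) ⊛ h) k
      ≡⟨ ⊛-cong {g = h} {g′ = h} (⊛-coeff-suc f g) (λ _ → refl) k ⟩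
    ((f 0 · shift g ⊕ shift f ⊛ g) ⊛ h) k
      ≡⟨ ⊛-distribʳ h (f 0 · shift g) (shift f ⊛ g) k ⟩
    ((f 0 · shift g) ⊛ h) k ℤ.+ ((shift f ⊛ g) ⊛ h) k
      ≡⟨ cong₂ ℤ._+_ (⊛-·ˡ (f 0) (shift g) h k) (⊛-assoc (shift f) g h k) ⟩
    f 0 ℤ.* (shift g ⊛ h) k ℤ.+ (shift f ⊛ (g ⊛ h)) k
      ∎
  regroup : ∀ a b c x y → a ℤ.* b ℤ.* c ℤ.+ (a ℤ.* x ℤ.+ y) ≡ a ℤ.* (b ℤ.* c ℤ.+ x) ℤ.+ y
  regroup = ℤSolver.solve-∀

record ConstantTermOne (f : Series) : Set where
  constructor constantTermOne
  field constantTerm : f 0 ≡ + 1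
open ConstantTermOne

invRev≡map-inv : ∀ f k → invRev f k ≡ map (λ i → inv f (k ∸ i)) (upTo (suc k))
invRev≡map-inv f zero    = refl
invRev≡map-inv f (suc k) = cong (inv f (suc k) ∷_) (trans (invRev≡map-inv f k)
  (trans (map-upTo _ (suc k)) (sym (map-applyUpTo suc (λ i → inv f (suc k ∸ i)) (suc k)))))

inv-inverseʳ : ∀ {f} → ConstantTermOne f → f ⊛ inv f ≈ 𝟙
inv-inverseʳ {f} (constantTermOne f₀≡1) zero    =
  trans (⊛-coeff-zero f (inv f)) (cong (ℤ._* + 1) f₀≡1)
inv-inverseʳ {f} (constantTermOne f₀≡1) (suc k) = begin
  (f ⊛ inv f) (suc k)                    ≡⟨ ⊛-coeff-suc f (inv f) k ⟩
  f 0 ℤ.* inv f (suc k) ℤ.+ tail         ≡⟨ cong (λ a → a ℤ.* inv f (suc k) ℤ.+ tail) f₀≡1 ⟩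
  + 1 ℤ.* inv f (suc k) ℤ.+ tail         ≡⟨ cong (ℤ._+ tail) (ℤP.*-identityˡ (inv f (suc k))) ⟩
  - sum (zipWith ℤ._*_ (map (f ∘ suc) (upTo (suc k))) (invRev f k)) ℤ.+ tail
                                         ≡⟨ cong (λ a → - a ℤ.+ tail) recurrence ⟩
  - tail ℤ.+ tail                        ≡⟨ ℤP.+-inverseˡ tail ⟩
  + 0                                    ∎
  where
  open ≡-Reasoning
  tail = (shift f ⊛ inv f) k
  recurrence : sum (zipWith ℤ._*_ (map (f ∘ suc) (upTo (suc k))) (invRev f k)) ≡ tail
  recurrence = cong sum
    (trans (cong (zipWith ℤ._*_ (map (f ∘ suc) (upTo (suc k)))) (invRev≡map-inv f k))
           (zipWith-*-map (f ∘ suc) (λ i → inv f (k ∸ i)) (upTo (suc k))))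

𝟘 : Series
𝟘 _ = + 0

neg : Series → Series
neg f k = - f k

⊕-isAbelianGroup : IsAbelianGroup _≈_ _⊕_ 𝟘 neg
⊕-isAbelianGroup = Pointwise.isAbelianGroup ℤP.+-0-isAbelianGroup

seriesRing : CommutativeRing _ _
seriesRing = record
  { Carrier = Series ; _≈_ = _≈_ ; _+_ = _⊕_ ; _*_ = _⊛_ ; -_ = neg ; 0# = 𝟘 ; 1# = 𝟙
  ; isCommutativeRing = record
    { isRing = record
      { +-isAbelianGroup = ⊕-isAbelianGroup
      ; *-cong           = ⊛-cong
      ; *-assoc          = ⊛-assoc
      ; *-identity       = comm∧idˡ⇒id ⊛-comm ⊛-identityˡ
      ; distrib          = comm∧distrʳ⇒distr ∙-cong ⊛-comm ⊛-distribʳ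
      }
    ; *-comm = ⊛-comm
    }
  }
  where
  open IsAbelianGroup ⊕-isAbelianGroup using (setoid; ∙-cong)
  open Consequences setoid using (comm∧idˡ⇒id; comm∧distrʳ⇒distr)

module R = CommutativeRing seriesRing
open import Relation.Binary.Reasoning.Setoid R.setoid

·-cong : ∀ c {f g} → f ≈ g → c · f ≈ c · g
·-cong c f≈g k = cong (c ℤ.*_) (f≈g k)

⊛-congˡ : ∀ f {g g′} → g ≈ g′ → f ⊛ g ≈ f ⊛ g′
⊛-congˡ f = R.*-congˡ {f}

⊛-congʳ : ∀ g {f f′} → f ≈ f′ → f ⊛ g ≈ f′ ⊛ g
⊛-congʳ g = R.*-congʳ {g}

⊖-cong : ∀ {f f′ g g′} → f ≈ f′ → g ≈ g′ → f ⊖ g ≈ f′ ⊖ g′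
⊖-cong f≈f′ g≈g′ k = cong₂ ℤ._-_ (f≈f′ k) (g≈g′ k)

⊖-congˡ : ∀ f {g g′} → g ≈ g′ → f ⊖ g ≈ f ⊖ g′
⊖-congˡ f g≈g′ k = cong (ℤ._-_ (f k)) (g≈g′ k)

-- Matching + 1 makes the solver's constant  con (+ 1)  evaluate to 𝟙 itself.
fromℤ : ℤ → Series
fromℤ (+ 1) = 𝟙
fromℤ c     = c · 𝟙

fromℤ≈·𝟙 : ∀ c → fromℤ c ≈ c · 𝟙
fromℤ≈·𝟙 (+ 1)           k = sym (ℤP.*-identityˡ (𝟙 k))
fromℤ≈·𝟙 (+ 0)           k = refl
fromℤ≈·𝟙 (+ suc (suc n)) k = refl
fromℤ≈·𝟙 ℤ.-[1+ n ]      k = refl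

fromℤ-⊛ : ∀ c f → fromℤ c ⊛ f ≈ c · f
fromℤ-⊛ c f = begin
  fromℤ c ⊛ f  ≈⟨ ⊛-congʳ f (fromℤ≈·𝟙 c) ⟩
  (c · 𝟙) ⊛ f  ≈⟨ ⊛-·ˡ c 𝟙 f ⟩
  c · (𝟙 ⊛ f)  ≈⟨ ·-cong c (⊛-identityˡ f) ⟩
  c · f        ∎

fromℤ-neg : ∀ c → fromℤ (- c) ≈ neg (fromℤ c)
fromℤ-neg c k = trans (fromℤ≈·𝟙 (- c) k)
  (trans (sym (ℤP.neg-distribˡ-* c (𝟙 k))) (cong -_ (sym (fromℤ≈·𝟙 c k))))

fromℤ-homomorphism :
  CommutativeRing.rawRing ℤP.+-*-commutativeRing -Raw-AlmostCommutative⟶ fromCommutativeRing seriesRing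
fromℤ-homomorphism = record
  { ⟦_⟧    = fromℤ
  ; +-homo = λ a b k → trans (fromℤ≈·𝟙 (a ℤ.+ b) k)
      (trans (ℤP.*-distribʳ-+ (𝟙 k) a b) (sym (cong₂ ℤ._+_ (fromℤ≈·𝟙 a k) (fromℤ≈·𝟙 b k))))
  ; *-homo = λ a b k → trans (fromℤ≈·𝟙 (a ℤ.* b) k)
      (trans (ℤP.*-assoc a b (𝟙 k))
             (trans (cong (a ℤ.*_) (sym (fromℤ≈·𝟙 b k))) (sym (fromℤ-⊛ a (fromℤ b) k))))
  ; -‿homo = fromℤ-neg
  ; 0-homo = λ _ → refl
  ; 1-homo = λ _ → refl
  }

fromℤ-≟ : ∀ a b → Maybe (fromℤ a ≈ fromℤ b)
fromℤ-≟ a b with a ℤ.≟ b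
... | yes refl = just R.refl
... | no _     = nothing

open RingSolver (CommutativeRing.rawRing ℤP.+-*-commutativeRing) (fromCommutativeRing seriesRing)
  fromℤ-homomorphism fromℤ-≟ using (solve; _:=_; _:+_; _:*_; _:-_; :-_; con)

⊖-telescope : ∀ a b c → (a ⊖ b) ⊕ (b ⊖ c) ≈ a ⊖ c
⊖-telescope = solve 3 (λ a b c → (a :- b) :+ (b :- c) := a :- c) R.refl

⊖-interchange : ∀ a b c d → (a ⊖ b) ⊖ (c ⊖ d) ≈ (a ⊖ c) ⊖ (b ⊖ d)
⊖-interchange = solve 4 (λ a b c d → (a :- b) :- (c :- d) := (a :- c) :- (b :- d)) R.refl

q^∣-resp : ∀ {e f g} → f ≈ g → q^ e ∣ f → q^ e ∣ g
q^∣-resp f≈g f≡0 k k<e = trans (sym (f≈g k)) (f≡0 k k<e)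

q^∣-mono : ∀ {d e f} → d ≤ e → q^ e ∣ f → q^ d ∣ f
q^∣-mono d≤e f≡0 k k<d = f≡0 k (ℕP.<-≤-trans k<d d≤e)

q^∣-⊕ : ∀ {e f g} → q^ e ∣ f → q^ e ∣ g → q^ e ∣ f ⊕ g
q^∣-⊕ f≡0 g≡0 k k<e = cong₂ ℤ._+_ (f≡0 k k<e) (g≡0 k k<e)

q^∣-⊖ : ∀ {e f g} → q^ e ∣ f → q^ e ∣ g → q^ e ∣ f ⊖ g
q^∣-⊖ f≡0 g≡0 k k<e = cong₂ ℤ._-_ (f≡0 k k<e) (g≡0 k k<e)

q^∣-· : ∀ {e f} c → q^ e ∣ f → q^ e ∣ c · f
q^∣-· c f≡0 k k<e = trans (cong (c ℤ.*_) (f≡0 k k<e)) (ℤP.*-zeroʳ c)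

infix 4 _≡_[q^_]
_≡_[q^_] : Series → Series → ℕ → Set
f ≡ g [q^ e ] = q^ e ∣ f ⊖ g

≡[q^]-refl : ∀ {e} f → f ≡ f [q^ e ]
≡[q^]-refl f k _ = ℤP.+-inverseʳ (f k)

≡[q^]-trans : ∀ {e f g h} → f ≡ g [q^ e ] → g ≡ h [q^ e ] → f ≡ h [q^ e ]
≡[q^]-trans {f = f} {g} {h} f≡g g≡h = q^∣-resp (⊖-telescope f g h) (q^∣-⊕ f≡g g≡h)

q^∣-resp-≡[q^] : ∀ {e f g} → f ≡ g [q^ e ] → q^ e ∣ g → q^ e ∣ f
q^∣-resp-≡[q^] {f = f} {g} f≡g g≡0 =
  q^∣-resp (solve 2 (λ f g → (f :- g) :+ g := f) R.refl f g) (q^∣-⊕ f≡g g≡0)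

inv-unique : ∀ {f g} → ConstantTermOne f → f ⊛ g ≈ 𝟙 → inv f ≈ g
inv-unique {f} {g} f₀≡1 fg≈1 = begin
  inv f            ≈⟨ R.*-identityʳ (inv f) ⟨
  inv f ⊛ 𝟙        ≈⟨ ⊛-congˡ (inv f) fg≈1 ⟨
  inv f ⊛ (f ⊛ g)  ≈⟨ R.*-assoc (inv f) f g ⟨
  (inv f ⊛ f) ⊛ g  ≈⟨ ⊛-congʳ g (R.trans (R.*-comm (inv f) f) (inv-inverseʳ f₀≡1)) ⟩
  𝟙 ⊛ g            ≈⟨ R.*-identityˡ g ⟩
  g                ∎

constantTermOne-⊛ : ∀ {f g} → ConstantTermOne f → ConstantTermOne g → ConstantTermOne (f ⊛ g)
constantTermOne-⊛ {f} {g} (constantTermOne f₀≡1) (constantTermOne g₀≡1) =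
  constantTermOne (trans (⊛-coeff-zero f g) (cong₂ ℤ._*_ f₀≡1 g₀≡1))

constantTermOne-𝟙⊖ : ∀ {f} → q^ 1 ∣ f → ConstantTermOne (𝟙 ⊖ f)
constantTermOne-𝟙⊖ f₀≡0 = constantTermOne (cong (ℤ._-_ (+ 1)) (f₀≡0 0 (s≤s z≤n)))

inv-⊛ : ∀ {f g} → ConstantTermOne f → ConstantTermOne g → inv (f ⊛ g) ≈ inv f ⊛ inv g
inv-⊛ {f} {g} f₀≡1 g₀≡1 = inv-unique (constantTermOne-⊛ f₀≡1 g₀≡1) (begin
  (f ⊛ g) ⊛ (inv f ⊛ inv g)
    ≈⟨ solve 4 (λ a b c d → (a :* b) :* (c :* d) := (a :* c) :* (b :* d)) R.refl f g (inv f) (inv g) ⟩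
  (f ⊛ inv f) ⊛ (g ⊛ inv g)
    ≈⟨ R.*-cong (inv-inverseʳ f₀≡1) (inv-inverseʳ g₀≡1) ⟩
  𝟙 ⊛ 𝟙
    ≈⟨ R.*-identityˡ 𝟙 ⟩
  𝟙
    ∎)

inv-factor : ∀ {f g h} → ConstantTermOne f → ConstantTermOne h → f ⊛ g ≈ h → inv f ≈ g ⊛ inv h
inv-factor {f} {g} {h} f₀≡1 h₀≡1 fg≈h = inv-unique f₀≡1 (begin
  f ⊛ (g ⊛ inv h)  ≈⟨ R.*-assoc f g (inv h) ⟨
  (f ⊛ g) ⊛ inv h  ≈⟨ ⊛-congʳ (inv h) fg≈h ⟩
  h ⊛ inv h        ≈⟨ inv-inverseʳ h₀≡1 ⟩
  𝟙                ∎)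

inv-cong : ∀ {f g} → ConstantTermOne f → f ≈ g → inv f ≈ inv g
inv-cong {g = g} f₀≡1 f≈g = inv-unique f₀≡1 (R.trans (⊛-congʳ (inv g) f≈g) (inv-inverseʳ g₀≡1))
  where
  g₀≡1 : ConstantTermOne g
  g₀≡1 = constantTermOne (trans (sym (f≈g 0)) (constantTerm f₀≡1))

geometric-difference : ∀ a x → ConstantTermOne (𝟙 ⊖ a) →
  x ⊛ inv (𝟙 ⊖ a) ⊖ (a ⊛ x) ⊛ inv (𝟙 ⊖ a) ≈ x
geometric-difference a x 1-a₀≡1 = begin
  x ⊛ i ⊖ (a ⊛ x) ⊛ i
    ≈⟨ solve 3 (λ x a i → x :* i :- (a :* x) :* i := x :* ((con (+ 1) :- a) :* i)) R.refl x a i ⟩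
  x ⊛ ((𝟙 ⊖ a) ⊛ i)
    ≈⟨ ⊛-congˡ x (inv-inverseʳ 1-a₀≡1) ⟩
  x ⊛ 𝟙
    ≈⟨ R.*-identityʳ x ⟩
  x
    ∎
  where i = inv (𝟙 ⊖ a)

qpow-below : ∀ {k d} → k < d → qpow d k ≡ + 0
qpow-below {zero}  {suc d} _         = refl
qpow-below {suc k} {suc d} (s≤s k<d) = qpow-below k<d

q^∣-qpow : ∀ {e d} → e ≤ d → q^ e ∣ qpow d
q^∣-qpow e≤d k k<e = qpow-below (ℕP.<-≤-trans k<e e≤d)

qpow-+ : ∀ a b → qpow (a + b) ≈ qpow a ⊛ qpow b
qpow-+ zero    b         = R.sym (R.*-identityˡ (qpow b))
qpow-+ (suc a) b zero    = sym (⊛-coeff-zero (qpow (suc a)) (qpow b))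
qpow-+ (suc a) b (suc k) = trans (qpow-+ a b k)
  (trans (sym (ℤP.+-identityˡ _)) (sym (⊛-coeff-suc (qpow (suc a)) (qpow b) k)))

-- Σ≥1 T k is the k-th coefficient of partialSum k T.
partialSum : ℕ → (ℕ → Series) → Series
partialSum N T k = sum (map (λ i → T (suc i) k) (upTo N))

partialSum-suc : ∀ N T → partialSum (suc N) T ≈ partialSum N T ⊕ T (suc N)
partialSum-suc N T k = sum-map-upTo-snoc (λ i → T (suc i) k) N

partialSum-⊖ : ∀ N T U → partialSum N (λ n → T n ⊖ U n) ≈ partialSum N T ⊖ partialSum N U
partialSum-⊖ zero    T U _ = refl
partialSum-⊖ (suc N) T U = begin
  partialSum (suc N) (λ n → T n ⊖ U n)
    ≈⟨ partialSum-suc N (λ n → T n ⊖ U n) ⟩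
  partialSum N (λ n → T n ⊖ U n) ⊕ (T (suc N) ⊖ U (suc N))
    ≈⟨ R.+-congʳ (partialSum-⊖ N T U) ⟩
  (partialSum N T ⊖ partialSum N U) ⊕ (T (suc N) ⊖ U (suc N))
    ≈⟨ solve 4 (λ a b c d → (a :- b) :+ (c :- d) := (a :+ c) :- (b :+ d))
               R.refl (partialSum N T) (partialSum N U) (T (suc N)) (U (suc N)) ⟩
  (partialSum N T ⊕ T (suc N)) ⊖ (partialSum N U ⊕ U (suc N))
    ≈⟨ ⊖-cong (partialSum-suc N T) (partialSum-suc N U) ⟨
  partialSum (suc N) T ⊖ partialSum (suc N) U
    ∎

partialSum-telescope : ∀ {T} (g : ℕ → Series) → (∀ n → T (suc n) ≈ g n ⊖ g (suc n)) →
  ∀ N → partialSum N T ≈ g 0 ⊖ g N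
partialSum-telescope     g step zero    k = sym (ℤP.+-inverseʳ (g 0 k))
partialSum-telescope {T} g step (suc N)   = begin
  partialSum (suc N) T             ≈⟨ partialSum-suc N T ⟩
  partialSum N T ⊕ T (suc N)       ≈⟨ R.+-cong (partialSum-telescope {T} g step N) (step N) ⟩
  (g 0 ⊖ g N) ⊕ (g N ⊖ g (suc N))  ≈⟨ ⊖-telescope (g 0) (g N) (g (suc N)) ⟩
  g 0 ⊖ g (suc N)                  ∎

q^∣-partialSum : ∀ {e T} → (∀ n → q^ e ∣ T (suc n)) → ∀ N → q^ e ∣ partialSum N T
q^∣-partialSum         T≡0 zero    _ _ = refl
q^∣-partialSum {T = T} T≡0 (suc N)     =
  q^∣-resp (R.sym (partialSum-suc N T)) (q^∣-⊕ (q^∣-partialSum {T = T} T≡0 N) (T≡0 N))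

constantTermOne-qPoch : ∀ r n → ConstantTermOne (qPoch (qpow (suc r)) n)
constantTermOne-qPoch r zero    = constantTermOne refl
constantTermOne-qPoch r (suc n) = constantTermOne-⊛ (constantTermOne-qPoch r n)
  (constantTermOne-𝟙⊖ (q^∣-⊛ʳ (qpow n) (q^∣-qpow (s≤s z≤n))))

qPoch-shift : ∀ s n → qPoch (qpow s) (suc n) ≈ (𝟙 ⊖ qpow s) ⊛ qPoch (qpow (suc s)) n
qPoch-shift s zero    =
  solve 1 (λ a → con (+ 1) :* (con (+ 1) :- a :* con (+ 1)) := (con (+ 1) :- a) :* con (+ 1)) R.refl (qpow s)
qPoch-shift s (suc n) = begin
  qPoch (qpow s) (suc n) ⊛ (𝟙 ⊖ qpow s ⊛ qpow (suc n))
    ≈⟨ R.*-cong (qPoch-shift s n) (⊖-congˡ 𝟙 exponent) ⟩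
  ((𝟙 ⊖ qpow s) ⊛ qPoch (qpow (suc s)) n) ⊛ (𝟙 ⊖ qpow (suc s) ⊛ qpow n)
    ≈⟨ R.*-assoc (𝟙 ⊖ qpow s) (qPoch (qpow (suc s)) n) (𝟙 ⊖ qpow (suc s) ⊛ qpow n) ⟩
  (𝟙 ⊖ qpow s) ⊛ qPoch (qpow (suc s)) (suc n)
    ∎
  where
  exponent : qpow s ⊛ qpow (suc n) ≈ qpow (suc s) ⊛ qpow n
  exponent = begin
    qpow s ⊛ qpow (suc n)  ≈⟨ qpow-+ s (suc n) ⟨
    qpow (s + suc n)       ≈⟨ R.reflexive (cong qpow (ℕP.+-suc s n)) ⟩
    qpow (suc s + n)       ≈⟨ qpow-+ (suc s) n ⟩
    qpow (suc s) ⊛ qpow n  ∎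

inv-qPoch-suc : ∀ r n →
  inv (qPoch (qpow (suc r)) n) ≈ (𝟙 ⊖ qpow (suc r) ⊛ qpow n) ⊛ inv (qPoch (qpow (suc r)) (suc n))
inv-qPoch-suc r n = inv-factor (constantTermOne-qPoch r n) (constantTermOne-qPoch r (suc n)) R.refl

inv-qPoch-shift : ∀ r n →
  inv (qPoch (qpow (suc (suc r))) n) ≈ (𝟙 ⊖ qpow (suc r)) ⊛ inv (qPoch (qpow (suc r)) (suc n))
inv-qPoch-shift r n = inv-factor (constantTermOne-qPoch (suc r) n) (constantTermOne-qPoch r (suc n))
  (R.trans (R.*-comm (qPoch (qpow (suc (suc r))) n) (𝟙 ⊖ qpow (suc r))) (R.sym (qPoch-shift (suc r) n)))

sign : ℕ → ℤ
sign n = (- (+ 1)) ^ℤ n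

fromℤ-sign-suc : ∀ n → fromℤ (sign (suc n)) ≈ neg (fromℤ (sign n))
fromℤ-sign-suc n = R.trans (R.reflexive (cong fromℤ (ℤP.-1*i≡-i (sign n)))) (fromℤ-neg (sign n))

stepExponent : ℕ → ℕ → ℕ
stepExponent s n = s * n + n C 2

[1+n]C2≡n+nC2 : ∀ n → suc n C 2 ≡ n + n C 2
[1+n]C2≡n+nC2 n = trans (sym (nCk+nC[k+1]≡[n+1]C[k+1] n 1)) (cong (_+ n C 2) (nC1≡n n))

s*n+[1+n]C2≡n+stepExponent : ∀ s n → s * n + suc n C 2 ≡ n + stepExponent s n
s*n+[1+n]C2≡n+stepExponent s n =
  trans (cong (_+_ (s * n)) ([1+n]C2≡n+nC2 n)) (+-x∙yz≈y∙xz (s * n) n (n C 2))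

r*n+[1+n]C2≡stepExponent : ∀ r n → r * n + suc n C 2 ≡ stepExponent (suc r) n
r*n+[1+n]C2≡stepExponent r n =
  trans (s*n+[1+n]C2≡n+stepExponent r n) (sym (ℕP.+-assoc n (r * n) (n C 2)))

stepExponent-suc : ∀ s n → stepExponent s (suc n) ≡ s + (n + stepExponent s n)
stepExponent-suc s n = trans (cong (_+ suc n C 2) (ℕP.*-suc s n))
  (trans (ℕP.+-assoc s (s * n) (suc n C 2)) (cong (_+_ s) (s*n+[1+n]C2≡n+stepExponent s n)))

lhsTerm : ℕ → ℕ → Series
lhsTerm s n = qpow (s * n) ⊛ inv (𝟙 ⊖ qpow n)

rhsTerm : ℕ → ℕ → Series
rhsTerm s n =
  sign (n ∸ 1) · (qpow ((s ∸ 1) * n) ⊛ qpow (suc n C 2)) ⊛ inv ((𝟙 ⊖ qpow n) ⊛ qPoch (qpow s) n)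

difference : ℕ → ℕ → Series
difference s n = lhsTerm s n ⊖ rhsTerm s n

rhsStep : ℕ → ℕ → Series
rhsStep s n = sign (n ∸ 1) · qpow (stepExponent s n) ⊛ inv (qPoch (qpow s) (suc n))

geometricTail : ℕ → ℕ → Series
geometricTail s N = qpow (s * suc N) ⊛ inv (𝟙 ⊖ qpow s)

rhsStepTail : ℕ → ℕ → Series
rhsStepTail s N = sign N · qpow (stepExponent s (suc N)) ⊛ inv (qPoch (qpow s) (suc N))

stepTail : ℕ → ℕ → Series
stepTail s N = geometricTail s N ⊖ rhsStepTail s N

lhsTerm-step : ∀ s n → lhsTerm s (suc n) ⊖ lhsTerm (suc s) (suc n) ≈ qpow (s * suc n)
lhsTerm-step s n = begin
  qpow (s * suc n) ⊛ i ⊖ qpow (suc n + s * suc n) ⊛ i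
    ≈⟨ ⊖-congˡ (qpow (s * suc n) ⊛ i) (⊛-congʳ i (qpow-+ (suc n) (s * suc n))) ⟩
  qpow (s * suc n) ⊛ i ⊖ (qpow (suc n) ⊛ qpow (s * suc n)) ⊛ i
    ≈⟨ geometric-difference (qpow (suc n)) (qpow (s * suc n)) (constantTermOne-𝟙⊖ (q^∣-qpow (s≤s z≤n))) ⟩
  qpow (s * suc n)
    ∎
  where i = inv (𝟙 ⊖ qpow (suc n))

rhsTerm-step : ∀ r n →
  rhsTerm (suc r) (suc n) ⊖ rhsTerm (suc (suc r)) (suc n) ≈ rhsStep (suc r) (suc n)
rhsTerm-step r n = begin
  rhsTerm s m ⊖ rhsTerm (suc s) m
    ≈⟨ ⊖-cong (R.*-cong numerator denominator) (R.*-cong numerator′ denominator′) ⟩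
  c ⊛ qpow E ⊛ (inv Q ⊛ ((𝟙 ⊖ qpow s ⊛ qpow m) ⊛ X))
    ⊖ c ⊛ (qpow m ⊛ qpow E) ⊛ (inv Q ⊛ ((𝟙 ⊖ qpow s) ⊛ X))
    ≈⟨ solve 6 (λ c e i x a b →
                  c :* e :* (i :* ((con (+ 1) :- a :* b) :* x))
                    :- c :* (b :* e) :* (i :* ((con (+ 1) :- a) :* x))
                  := c :* e :* x :* ((con (+ 1) :- b) :* i))
               R.refl c (qpow E) (inv Q) X (qpow s) (qpow m) ⟩
  c ⊛ qpow E ⊛ X ⊛ (Q ⊛ inv Q)
    ≈⟨ ⊛-congˡ (c ⊛ qpow E ⊛ X) (inv-inverseʳ Q₀≡1) ⟩
  c ⊛ qpow E ⊛ X ⊛ 𝟙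
    ≈⟨ R.*-identityʳ (c ⊛ qpow E ⊛ X) ⟩
  c ⊛ qpow E ⊛ X
    ≈⟨ ⊛-congʳ X (fromℤ-⊛ (sign n) (qpow E)) ⟩
  rhsStep s m
    ∎
  where
  s = suc r
  m = suc n
  c = fromℤ (sign n)
  E = stepExponent s m
  Q = 𝟙 ⊖ qpow m
  X = inv (qPoch (qpow s) (suc m))
  Q₀≡1 : ConstantTermOne Q
  Q₀≡1 = constantTermOne-𝟙⊖ (q^∣-qpow (s≤s z≤n))
  numerator : sign n · (qpow (r * m) ⊛ qpow (suc m C 2)) ≈ c ⊛ qpow E
  numerator = begin
    sign n · (qpow (r * m) ⊛ qpow (suc m C 2))
      ≈⟨ ·-cong (sign n) (qpow-+ (r * m) (suc m C 2)) ⟨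
    sign n · qpow (r * m + suc m C 2)
      ≈⟨ ·-cong (sign n) (R.reflexive (cong qpow (r*n+[1+n]C2≡stepExponent r m))) ⟩
    sign n · qpow E
      ≈⟨ fromℤ-⊛ (sign n) (qpow E) ⟨
    c ⊛ qpow E
      ∎
  numerator′ : sign n · (qpow (s * m) ⊛ qpow (suc m C 2)) ≈ c ⊛ (qpow m ⊛ qpow E)
  numerator′ = begin
    sign n · (qpow (s * m) ⊛ qpow (suc m C 2))
      ≈⟨ ·-cong (sign n) (qpow-+ (s * m) (suc m C 2)) ⟨
    sign n · qpow (s * m + suc m C 2)
      ≈⟨ ·-cong (sign n) (R.reflexive (cong qpow (s*n+[1+n]C2≡n+stepExponent s m))) ⟩
    sign n · qpow (m + E)
      ≈⟨ fromℤ-⊛ (sign n) (qpow (m + E)) ⟨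
    c ⊛ qpow (m + E)
      ≈⟨ ⊛-congˡ c (qpow-+ m E) ⟩
    c ⊛ (qpow m ⊛ qpow E)
      ∎
  denominator : inv (Q ⊛ qPoch (qpow s) m) ≈ inv Q ⊛ ((𝟙 ⊖ qpow s ⊛ qpow m) ⊛ X)
  denominator = R.trans (inv-⊛ Q₀≡1 (constantTermOne-qPoch r m))
                        (⊛-congˡ (inv Q) (inv-qPoch-suc r m))
  denominator′ : inv (Q ⊛ qPoch (qpow (suc s)) m) ≈ inv Q ⊛ ((𝟙 ⊖ qpow s) ⊛ X)
  denominator′ = R.trans (inv-⊛ Q₀≡1 (constantTermOne-qPoch s m))
                         (⊛-congˡ (inv Q) (inv-qPoch-shift r m))

geometricTail-step : ∀ r N →
  geometricTail (suc r) N ⊖ geometricTail (suc r) (suc N) ≈ qpow (suc r * suc N)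
geometricTail-step r N = begin
  qpow (s * suc N) ⊛ i ⊖ qpow (s * suc (suc N)) ⊛ i
    ≈⟨ ⊖-congˡ (qpow (s * suc N) ⊛ i) (⊛-congʳ i exponent) ⟩
  qpow (s * suc N) ⊛ i ⊖ (qpow s ⊛ qpow (s * suc N)) ⊛ i
    ≈⟨ geometric-difference (qpow s) (qpow (s * suc N)) (constantTermOne-𝟙⊖ (q^∣-qpow (s≤s z≤n))) ⟩
  qpow (s * suc N)
    ∎
  where
  s = suc r
  i = inv (𝟙 ⊖ qpow s)
  exponent : qpow (s * suc (suc N)) ≈ qpow s ⊛ qpow (s * suc N)
  exponent = R.trans (R.reflexive (cong qpow (ℕP.*-suc s (suc N)))) (qpow-+ s (s * suc N))

rhsStepTail-step : ∀ r N →
  rhsStepTail (suc r) N ⊖ rhsStepTail (suc r) (suc N) ≈ rhsStep (suc r) (suc N)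
rhsStepTail-step r N = begin
  rhsStepTail s N ⊖ rhsStepTail s m
    ≈⟨ ⊖-cong (R.*-cong (R.sym (fromℤ-⊛ (sign N) Y)) (inv-qPoch-suc r m)) (⊛-congʳ X numerator) ⟩
  c ⊛ Y ⊛ ((𝟙 ⊖ qpow s ⊛ qpow m) ⊛ X) ⊖ neg c ⊛ (qpow s ⊛ (qpow m ⊛ Y)) ⊛ X
    ≈⟨ solve 5 (λ c y x a b →
                  c :* y :* ((con (+ 1) :- a :* b) :* x) :- (:- c) :* (a :* (b :* y)) :* x
                  := c :* y :* x)
               R.refl c Y X (qpow s) (qpow m) ⟩
  c ⊛ Y ⊛ X
    ≈⟨ ⊛-congʳ X (fromℤ-⊛ (sign N) Y) ⟩
  rhsStep s m
    ∎
  where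
  s = suc r
  m = suc N
  c = fromℤ (sign N)
  Y = qpow (stepExponent s m)
  X = inv (qPoch (qpow s) (suc m))
  exponent : qpow (stepExponent s (suc m)) ≈ qpow s ⊛ (qpow m ⊛ Y)
  exponent = R.trans (R.reflexive (cong qpow (stepExponent-suc s m)))
    (R.trans (qpow-+ s (m + stepExponent s m)) (⊛-congˡ (qpow s) (qpow-+ m (stepExponent s m))))
  numerator : sign m · qpow (stepExponent s (suc m)) ≈ neg c ⊛ (qpow s ⊛ (qpow m ⊛ Y))
  numerator = begin
    sign m · qpow (stepExponent s (suc m))          ≈⟨ fromℤ-⊛ (sign m) _ ⟨
    fromℤ (sign m) ⊛ qpow (stepExponent s (suc m))  ≈⟨ R.*-cong (fromℤ-sign-suc N) exponent ⟩
    neg c ⊛ (qpow s ⊛ (qpow m ⊛ Y))                 ∎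

stepTail-zero : ∀ r → stepTail (suc r) 0 ≈ 𝟘
stepTail-zero r k =
  trans (cong (ℤ._- rhsStepTail s 0 k) (tails-agree k)) (ℤP.+-inverseʳ (rhsStepTail s 0 k))
  where
  s = suc r
  tails-agree : geometricTail s 0 ≈ rhsStepTail s 0
  tails-agree = R.sym (R.*-cong
    (λ k → trans (ℤP.*-identityˡ _) (cong (λ e → qpow e k) (ℕP.+-identityʳ (s * 1))))
    (inv-cong (constantTermOne-qPoch r 1) (R.trans (qPoch-shift s 0) (R.*-identityʳ (𝟙 ⊖ qpow s)))))

q^∣-stepTail : ∀ r N → q^ (suc N) ∣ stepTail (suc r) N
q^∣-stepTail r N = q^∣-⊖
  (q^∣-⊛ʳ (inv (𝟙 ⊖ qpow (suc r))) (q^∣-qpow N<sN))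
  (q^∣-⊛ʳ (inv (qPoch (qpow (suc r)) (suc N)))
          (q^∣-· (sign N) (q^∣-qpow (ℕP.≤-trans N<sN (ℕP.m≤m+n _ (suc N C 2))))))
  where
  N<sN : suc N ≤ suc r * suc N
  N<sN = ℕP.m≤n*m (suc N) (suc r)

difference-step : ∀ r n →
  difference (suc r) (suc n) ⊖ difference (suc (suc r)) (suc n)
    ≈ stepTail (suc r) n ⊖ stepTail (suc r) (suc n)
difference-step r n = begin
  (lhsTerm s m ⊖ rhsTerm s m) ⊖ (lhsTerm (suc s) m ⊖ rhsTerm (suc s) m)
    ≈⟨ ⊖-interchange (lhsTerm s m) (rhsTerm s m) (lhsTerm (suc s) m) (rhsTerm (suc s) m) ⟩
  (lhsTerm s m ⊖ lhsTerm (suc s) m) ⊖ (rhsTerm s m ⊖ rhsTerm (suc s) m)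
    ≈⟨ ⊖-cong (lhsTerm-step s n) (rhsTerm-step r n) ⟩
  qpow (s * m) ⊖ rhsStep s m
    ≈⟨ ⊖-cong (geometricTail-step r n) (rhsStepTail-step r n) ⟨
  (geometricTail s n ⊖ geometricTail s m) ⊖ (rhsStepTail s n ⊖ rhsStepTail s m)
    ≈⟨ ⊖-interchange (geometricTail s n) (geometricTail s m) (rhsStepTail s n) (rhsStepTail s m) ⟩
  stepTail s n ⊖ stepTail s m
    ∎
  where
  s = suc r
  m = suc n

partialSum-difference-step : ∀ r N →
  partialSum N (difference (suc r)) ≡ partialSum N (difference (suc (suc r))) [q^ suc N ]
partialSum-difference-step r N = q^∣-resp telescoped
  (q^∣-⊖ (q^∣-resp (R.sym (stepTail-zero r)) (λ _ _ → refl)) (q^∣-stepTail r N))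
  where
  telescoped : stepTail (suc r) 0 ⊖ stepTail (suc r) N
             ≈ partialSum N (difference (suc r)) ⊖ partialSum N (difference (suc (suc r)))
  telescoped = R.trans
    (R.sym (partialSum-telescope {λ n → difference (suc r) n ⊖ difference (suc (suc r)) n}
                                 (stepTail (suc r)) (difference-step r) N))
    (partialSum-⊖ N (difference (suc r)) (difference (suc (suc r))))

partialSum-difference-shift : ∀ j r N →
  partialSum N (difference (suc r)) ≡ partialSum N (difference (suc (j + r))) [q^ suc N ]
partialSum-difference-shift zero    r N = ≡[q^]-refl (partialSum N (difference (suc r)))
partialSum-difference-shift (suc j) r N =
  ≡[q^]-trans {f = partialSum N (difference (suc r))} {g = partialSum N (difference (suc (j + r)))}
              (partialSum-difference-shift j r N) (partialSum-difference-step (j + r) N)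

q^∣-lhsTerm : ∀ s n → q^ s ∣ lhsTerm s (suc n)
q^∣-lhsTerm s n = q^∣-⊛ʳ (inv (𝟙 ⊖ qpow (suc n))) (q^∣-qpow (ℕP.m≤m*n s (suc n)))

q^∣-rhsTerm : ∀ r n → q^ (suc r) ∣ rhsTerm (suc r) (suc n)
q^∣-rhsTerm r n = q^∣-⊛ʳ (inv ((𝟙 ⊖ qpow (suc n)) ⊛ qPoch (qpow (suc r)) (suc n)))
  (q^∣-· (sign n) (q^∣-resp (qpow-+ (r * suc n) (suc (suc n) C 2)) (q^∣-qpow bound)))
  where
  bound : suc r ≤ r * suc n + suc (suc n) C 2
  bound = ℕP.≤-trans (ℕP.≤-trans (ℕP.m≤m*n (suc r) (suc n)) (ℕP.m≤m+n (suc r * suc n) (suc n C 2)))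
                     (ℕP.≤-reflexive (sym (r*n+[1+n]C2≡stepExponent r (suc n))))

q^∣-partialSum-difference : ∀ r N → q^ (suc r) ∣ partialSum N (difference (suc r))
q^∣-partialSum-difference r = q^∣-partialSum {T = difference (suc r)}
  (λ n → q^∣-⊖ (q^∣-lhsTerm (suc r) n) (q^∣-rhsTerm r n))

partialSum-difference≡0 : ∀ r N → q^ (suc N) ∣ partialSum N (difference (suc r))
partialSum-difference≡0 r N = q^∣-resp-≡[q^] (partialSum-difference-shift N r N)
  (q^∣-mono (s≤s (ℕP.m≤m+n N r)) (q^∣-partialSum-difference (N + r) N))

Σ≥1-lhsTerm≈Σ≥1-rhsTerm : ∀ r → Σ≥1 (lhsTerm (suc r)) ≈ Σ≥1 (rhsTerm (suc r))
Σ≥1-lhsTerm≈Σ≥1-rhsTerm r k = ℤP.i-j≡0⇒i≡j _ _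
  (trans (sym (partialSum-⊖ k (lhsTerm (suc r)) (rhsTerm (suc r)) k))
         (partialSum-difference≡0 r k k (ℕP.n<1+n k)))

proposition5p11 : (m : ℕ) → 1 ≤ m →
    Σ≥1 (λ n → qpow (2 * m * n) ⊛ inv (𝟙 ⊖ qpow n))
      ≈ Σ≥1 (λ n → ((- (+ 1)) ^ℤ (n ∸ 1))
                    · (qpow ((2 * m ∸ 1) * n) ⊛ qpow (suc n C 2))
                    ⊛ inv ((𝟙 ⊖ qpow n) ⊛ qPoch (qpow (2 * m)) n))
proposition5p11 (suc m) _ = Σ≥1-lhsTerm≈Σ≥1-rhsTerm _
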